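{- For every $n\ge 1$, $s(n)\le \lfloor \log_2 p_n\rfloor$.
   Context: $p_n$ denotes the $n$-th prime. For an integer $k\ge 3$, say that a positive integer $m$ is represented by $F_k$ if there are integers $1\le x_1\le\dots\le x_k$ with $m=x_1\cdots x_k+x_1+\dots+x_k$. Define $s(n)$ to be the smallest integer $k\ge 3$ such that $p_n+k-3$ is represented by $F_k$, and $s(n)=0$ if there is no such $k$. -}

module Defs where

open import Data.Nat using (ℕ; zero; suc; _+_; _*_; _∸_; _≤_; _<_)
open import Data.Nat.Primality using (Prime; prime?)
open import Data.Nat.Logarithm using (⌊log₂_⌋)
open import Data.Fin as Fin using (Fin)
open import Data.Vec using (Vec; lookup; sum; foldr′)
open import Data.List using (List; length; filter; upTo)
open import Data.Product using (Σ; _×_)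
open import Relation.Nullary using (¬_)

prod : ∀ {k} → Vec ℕ k → ℕ
prod = foldr′ _*_ 1

RepresentedBy : (k m : ℕ) → Set
RepresentedBy k m =
  Σ (Vec ℕ k) λ xs →
    (∀ (i : Fin k) → 1 ≤ lookup xs i) ×
    (∀ (i j : Fin k) → i Fin.≤ j → lookup xs i ≤ lookup xs j) ×
    (m ≡ prod xs + sum xs)
  where open import Relation.Binary.PropositionalEquality using (_≡_)

primeCount : ℕ → ℕ
primeCount p = length (filter prime? (upTo (suc p)))

-- p is the n-th prime p_n (with p_1 = 2)
IsNthPrime : ℕ → ℕ → Set
IsNthPrime n p = Prime p × (primeCount p ≡ n)
  where open import Relation.Binary.PropositionalEquality using (_≡_)

-- s(n) = k, as a relation on the prime p = p_n:
-- either k is the least k ≥ 3 such that p + k - 3 is represented by F_k,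
-- or k = 0 and no k ≥ 3 has this property.
IsS : (p k : ℕ) → Set
IsS p k =
  (3 ≤ k × RepresentedBy k (p + k ∸ 3) ×
     (∀ j → 3 ≤ j → j < k → ¬ RepresentedBy j (p + j ∸ 3)))
  ⊎ (k ≡ 0 × (∀ j → 3 ≤ j → ¬ RepresentedBy j (p + j ∸ 3)))
  where open import Relation.Binary.PropositionalEquality using (_≡_)
        open import Data.Sum using (_⊎_)

{-# OPTIONS --safe #-}
-- If the least k ≥ 3 has a representation p + k - 3 = x₁⋯x_k + x₁ + … + x_k
-- with x₁ = 1, then either k = 3, where p = (1 + x₂)(1 + x₃) is not prime, or
-- the leading 1 can be dropped to represent p + (k - 1) - 3 by F_{k-1},
-- contradicting minimality. Hence every xᵢ ≥ 2, and 2^k + k ≤ p + k - 3.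
module Submission where

open import Defs
open import Data.Nat using (ℕ; zero; suc; _+_; _*_; _∸_; _^_; _≤_; _<_; z≤n; s≤s)
open import Data.Nat.Properties
open import Data.Nat.Logarithm using (⌊log₂_⌋; ⌊log₂⌋-mono-≤; ⌊log₂[2^n]⌋≡n)
open import Data.Nat.Primality using (Prime; composite-≢; composite⇒¬prime)
open import Data.Nat.Divisibility using (m∣m*n)
open import Data.Nat.Solver using (module +-*-Solver)
open import Data.Fin as Fin using (zero; suc)
open import Data.Vec using (Vec; []; _∷_; lookup; sum)
open import Data.Product using (_,_)
open import Data.Sum using (inj₁; inj₂)
open import Relation.Nullary using (¬_)
open import Data.Empty using (⊥-elim)
open import Function using (_$_)
open import Relation.Binary.PropositionalEquality
open ≤-Reasoning

F : ∀ {k} → Vec ℕ k → ℕ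
F xs = prod xs + sum xs

Positive : ∀ {k} → Vec ℕ k → Set
Positive xs = ∀ i → 1 ≤ lookup xs i

Ascending : ∀ {k} → Vec ℕ k → Set
Ascending xs = ∀ i j → i Fin.≤ j → lookup xs i ≤ lookup xs j

2^k≤n⇒k≤⌊log₂n⌋ : ∀ {k n} → 2 ^ k ≤ n → k ≤ ⌊log₂ n ⌋
2^k≤n⇒k≤⌊log₂n⌋ {k} 2^k≤n = subst (_≤ _) (⌊log₂[2^n]⌋≡n k) (⌊log₂⌋-mono-≤ 2^k≤n)

¬prime-product : ∀ {a b} → 2 ≤ a → 2 ≤ b → ¬ Prime (a * b)
¬prime-product {a} {b} (s≤s (s≤s _)) 2≤b@(s≤s (s≤s _)) =
  composite⇒¬prime (composite-≢ a (<⇒≢ (m<m*n a b 2≤b)) (m∣m*n b))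

b^k≤prod : ∀ {b k} (xs : Vec ℕ k) → (∀ i → b ≤ lookup xs i) → b ^ k ≤ prod xs
b^k≤prod []       _     = ≤-refl
b^k≤prod (x ∷ xs) b≤xs = *-mono-≤ (b≤xs zero) (b^k≤prod xs (λ i → b≤xs (suc i)))

k≤sum : ∀ {k} (xs : Vec ℕ k) → Positive xs → k ≤ sum xs
k≤sum []       _   = z≤n
k≤sum (x ∷ xs) pos = +-mono-≤ (pos zero) (k≤sum xs (λ i → pos (suc i)))

2^k+k≤F : ∀ {k} (xs : Vec ℕ k) → (∀ i → 2 ≤ lookup xs i) → 2 ^ k + k ≤ F xs
2^k+k≤F xs 2≤xs = +-mono-≤ (b^k≤prod xs 2≤xs) (k≤sum xs (λ i → ≤-trans (s≤s z≤n) (2≤xs i)))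

F[1,y,z]≡[1+y][1+z] : ∀ y z → F (1 ∷ y ∷ z ∷ []) ≡ suc y * suc z
F[1,y,z]≡[1+y][1+z] = solve 2 (λ y z →
    con 1 :* (y :* (z :* con 1)) :+ (con 1 :+ (y :+ (z :+ con 0)))
      := (con 1 :+ y) :* (con 1 :+ z)) refl
  where open +-*-Solver

drop-leading-one : ∀ {k m} {xs : Vec ℕ k} → Positive (1 ∷ xs) → Ascending (1 ∷ xs) →
                   suc m ≡ F (1 ∷ xs) → RepresentedBy k m
drop-leading-one {m = m} {xs = xs} pos asc eq =
  xs , (λ i → pos (suc i)) , (λ i j i≤j → asc (suc i) (suc j) (s≤s i≤j)) , m≡F
  where
  m≡F : m ≡ F xs
  m≡F = suc-injective (trans eq (trans (cong (_+ suc (sum xs)) (+-identityʳ (prod xs)))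
                                       (+-suc (prod xs) (sum xs))))

p+[3+j]∸3≡p+j : ∀ p j → p + (3 + j) ∸ 3 ≡ p + j
p+[3+j]∸3≡p+j p j = +-∸-assoc p (m≤m+n 3 j)

leading-entry≥2 : ∀ {p j x} {xs : Vec ℕ (2 + j)} → Prime p →
                  Positive (x ∷ xs) → Ascending (x ∷ xs) → p + j ≡ F (x ∷ xs) →
                  (∀ i → 3 ≤ i → i < 3 + j → ¬ RepresentedBy i (p + i ∸ 3)) →
                  2 ≤ x
leading-entry≥2 {x = suc (suc _)} _ _ _ _ _ = s≤s (s≤s z≤n)
leading-entry≥2 {x = zero} _ pos _ _ _ with () ← pos zero
leading-entry≥2 {p} {zero} {1} {y ∷ z ∷ []} p-prime pos _ eq _ = ⊥-elim $
  ¬prime-product (s≤s (pos (suc zero))) (s≤s (pos (suc (suc zero))))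
    (subst Prime (trans (sym (+-identityʳ p)) (trans eq (F[1,y,z]≡[1+y][1+z] y z))) p-prime)
leading-entry≥2 {p} {suc j} {1} _ pos asc eq minimal = ⊥-elim $
  minimal (3 + j) (s≤s (s≤s (s≤s z≤n))) ≤-refl
    (subst (λ m → RepresentedBy (3 + j) m) (sym (p+[3+j]∸3≡p+j p j))
      (drop-leading-one pos asc (trans (sym (+-suc p j)) eq)))

proposition4 : ∀ (n p k : ℕ) → 1 ≤ n → IsNthPrime n p → IsS p k → k ≤ ⌊log₂ p ⌋
proposition4 _ _ _ _ _ (inj₂ (refl , _)) = z≤n
proposition4 _ p (suc (suc (suc j))) _ (p-prime , _)
             (inj₁ (s≤s (s≤s (s≤s z≤n)) , (x ∷ xs , pos , asc , eq) , minimal)) =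
  2^k≤n⇒k≤⌊log₂n⌋ (+-cancelʳ-≤ j (2 ^ k) p (begin
    2 ^ k + j     ≤⟨ +-monoʳ-≤ (2 ^ k) (m≤n+m j 3) ⟩
    2 ^ k + k     ≤⟨ 2^k+k≤F (x ∷ xs) 2≤xs ⟩
    F (x ∷ xs)    ≡⟨ eq′ ⟨
    p + j         ∎))
  where
  k : ℕ
  k = 3 + j
  eq′ : p + j ≡ F (x ∷ xs)
  eq′ = trans (sym (p+[3+j]∸3≡p+j p j)) eq
  2≤xs : ∀ i → 2 ≤ lookup (x ∷ xs) i
  2≤xs i = ≤-trans (leading-entry≥2 p-prime pos asc eq′ minimal) (asc zero i z≤n)
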